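{- Let $r\in[1,n-1]$ and $A=\{1,2,\ldots,r\}\subseteq\mathbb{Z}_n$. Then $C_A(n)=\lceil n/r\rceil$.
   Context: $\mathbb{Z}_n=\mathbb{Z}/n\mathbb{Z}$. For $A\subseteq\mathbb{Z}_n$, an $A$-weighted zero-sum subsequence of consecutive terms of a sequence $(x_1,\ldots,x_k)$ in $\mathbb{Z}_n$ is given by a non-empty set $I\subseteq[1,k]$ of consecutive integers and $a_i\in A$ ($i\in I$) with $\sum_{i\in I}a_ix_i=0$. $C_A(n)$ is the least positive integer $k$ such that every sequence of length $k$ in $\mathbb{Z}_n$ has such a subsequence. $\lceil x\rceil$ is the smallest integer $\ge x$. -}

module Defs where

open import Data.Nat using (ℕ; zero; suc; _+_; _*_; _∸_; _≤_; _<_; NonZero; _<?_)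
open import Data.Nat.DivMod using (_%_; _/_)
open import Data.Fin using (Fin; toℕ; fromℕ<)
open import Data.Product using (Σ; ∃; _×_; _,_)
open import Relation.Binary.PropositionalEquality using (_≡_)
open import Relation.Nullary using (yes; no)

-- Σ_{t = i}^{i + m} f t   (m + 1 consecutive terms starting at index i)
blockSum : (ℕ → ℕ) → ℕ → ℕ → ℕ
blockSum f i zero    = f i
blockSum f i (suc m) = f i + blockSum f (suc i) m

-- a sequence (x_1,…,x_k) in ℤ_n, indexed 0..k-1, read as a function on ℕ
-- (indices ≥ k are never used below; they are sent to 0)
seqAt : ∀ {n k} → (Fin k → Fin n) → ℕ → ℕ
seqAt {k = k} x t with t <? k
... | yes t<k = toℕ (x (fromℕ< t<k))
... | no  _   = 0

-- A = {1,…,r} ⊆ ℤ_n, represented by the integers 1..r (distinct residues since r < n)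
InA : ℕ → ℕ → Set
InA r a = (1 ≤ a) × (a ≤ r)

HasZeroSumBlock : (n r k : ℕ) .{{_ : NonZero n}} → (Fin k → Fin n) → Set
HasZeroSumBlock n r k x =
  Σ ℕ λ i → Σ ℕ λ m → (i + m < k) ×
    Σ (ℕ → ℕ) λ a → (∀ t → i ≤ t → t ≤ i + m → InA r (a t)) ×
      (blockSum (λ t → a t * seqAt x t) i m % n ≡ 0)

AllHave : (n r k : ℕ) .{{_ : NonZero n}} → Set
AllHave n r k = (x : Fin k → Fin n) → HasZeroSumBlock n r k x

IsCA : (n r c : ℕ) .{{_ : NonZero n}} → Set
IsCA n r c = (1 ≤ c) × AllHave n r c × (∀ k → 1 ≤ k → AllHave n r k → c ≤ k)

ceilDiv : (m d : ℕ) .{{_ : NonZero d}} → ℕ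
ceilDiv m d = (m + (d ∸ 1)) / d

-- Repeat every term of x = (x_0, …, x_{k-1}) r times and take prefix sums S_0, …, S_{kr} of the
-- stretched sequence. If k = ⌈n/r⌉ these are at least n + 1 numbers, so two agree modulo n; their
-- difference S_q − S_p is a sum over a run of consecutive x_s, each taken with a multiplicity in
-- [1, r], hence an A-weighted zero-sum block. Conversely, for k < ⌈n/r⌉ every A-weighted block sum
-- of the constant sequence 1 lies in [1, kr] ⊆ [1, n − 1] and so is never 0 modulo n.
module Submission where

open import Defs
open import Data.Nat using (ℕ; zero; suc; _+_; _*_; _∸_; _≤_; _<_; _≤′_; ≤′-refl; ≤′-step; z≤n; s≤s; z<s; NonZero; >-nonZero⁻¹; _<?_; _≟_)
open import Data.Nat.Properties
open import Data.Nat.DivMod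
open import Data.Nat.Divisibility using (divides-refl)
open import Data.Fin using (Fin; toℕ; fromℕ<)
open import Data.Fin.Properties using (pigeonhole; toℕ-fromℕ<; toℕ<n)
open import Data.Product using (_×_; _,_; proj₁; proj₂)
open import Data.Sum using (_⊎_; inj₁; inj₂)
open import Relation.Binary.PropositionalEquality
open import Relation.Nullary using (yes; no; ¬_; contradiction)

prefixSum : (ℕ → ℕ) → ℕ → ℕ
prefixSum f zero    = 0
prefixSum f (suc k) = prefixSum f k + f k

setAt : (ℕ → ℕ) → ℕ → ℕ → ℕ → ℕ
setAt f d v s with s ≟ d
... | yes _ = v
... | no  _ = f s

setAt-≡ : ∀ f d v → setAt f d v d ≡ v
setAt-≡ f d v with d ≟ d
... | yes _   = refl
... | no  d≢d = contradiction refl d≢d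

setAt-≢ : ∀ f d v {s} → s ≢ d → setAt f d v s ≡ f s
setAt-≢ f d v {s} s≢d with s ≟ d
... | yes s≡d = contradiction s≡d s≢d
... | no  _   = refl

setAt-elim : (P : ℕ → Set) → ∀ f d v s → (s ≡ d → P v) → (s ≢ d → P (f s)) → P (setAt f d v s)
setAt-elim P f d v s at-d elsewhere with s ≟ d
... | yes s≡d = at-d s≡d
... | no  s≢d = elsewhere s≢d

blockSum-cong : ∀ {f g} i m → (∀ t → i ≤ t → t ≤ i + m → f t ≡ g t) → blockSum f i m ≡ blockSum g i m
blockSum-cong i zero    f≗g = f≗g i ≤-refl (m≤m+n i 0)
blockSum-cong i (suc m) f≗g = cong₂ _+_ (f≗g i ≤-refl (m≤m+n i (suc m)))
  (blockSum-cong (suc i) m λ t i<t t≤ → f≗g t (<⇒≤ i<t) (≤-trans t≤ (≤-reflexive (sym (+-suc i m)))))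

blockSum-snoc : ∀ f i m → blockSum f i (suc m) ≡ blockSum f i m + f (suc (i + m))
blockSum-snoc f i zero    = cong (λ j → f i + f (suc j)) (sym (+-identityʳ i))
blockSum-snoc f i (suc m) = begin
  f i + blockSum f (suc i) (suc m)            ≡⟨ cong (f i +_) (blockSum-snoc f (suc i) m) ⟩
  f i + (blockSum f (suc i) m + f (suc (suc i + m))) ≡⟨ +-assoc (f i) _ _ ⟨
  blockSum f i (suc m) + f (suc (suc i + m))  ≡⟨ cong (λ j → blockSum f i (suc m) + f (suc j)) (+-suc i m) ⟨
  blockSum f i (suc m) + f (suc (i + suc m))  ∎
  where open ≡-Reasoning

blockSum-bumpLast : ∀ {f g} y i m → (∀ t → i ≤ t → t < i + m → g t ≡ f t) →
  g (i + m) ≡ f (i + m) + y → blockSum g i m ≡ blockSum f i m + y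
blockSum-bumpLast {f} {g} y i zero _ gLast = subst (λ j → g j ≡ f j + y) (+-identityʳ i) gLast
blockSum-bumpLast {f} {g} y i (suc m) g≗f gLast = begin
  g i + blockSum g (suc i) m       ≡⟨ cong₂ _+_ (g≗f i ≤-refl (m<m+n i z<s)) rest ⟩
  f i + (blockSum f (suc i) m + y) ≡⟨ +-assoc (f i) _ y ⟨
  blockSum f i (suc m) + y         ∎
  where
  open ≡-Reasoning
  rest : blockSum g (suc i) m ≡ blockSum f (suc i) m + y
  rest = blockSum-bumpLast y (suc i) m
    (λ t i<t t< → g≗f t (<⇒≤ i<t) (≤-trans t< (≤-reflexive (sym (+-suc i m)))))
    (subst (λ j → g j ≡ f j + y) (+-suc i m) gLast)

head≤blockSum : ∀ f i m → f i ≤ blockSum f i m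
head≤blockSum f i zero    = ≤-refl
head≤blockSum f i (suc m) = m≤m+n (f i) _

blockSum-≤ : ∀ {f} b i m → (∀ t → i ≤ t → t ≤ i + m → f t ≤ b) → blockSum f i m ≤ suc m * b
blockSum-≤ b i zero    f≤b = ≤-trans (f≤b i ≤-refl (m≤m+n i 0)) (≤-reflexive (sym (+-identityʳ b)))
blockSum-≤ b i (suc m) f≤b = +-mono-≤ (f≤b i ≤-refl (m≤m+n i (suc m)))
  (blockSum-≤ b (suc i) m λ t i<t t≤ → f≤b t (<⇒≤ i<t) (≤-trans t≤ (≤-reflexive (sym (+-suc i m)))))

suc-/-% : ∀ t r .{{_ : NonZero r}} →
  (suc t / r ≡ t / r × suc t % r ≡ suc (t % r)) ⊎ suc t / r ≡ suc (t / r)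
suc-/-% t r with suc (t % r) <? r
... | yes 1+t%r<r = inj₁ (quotient , remainder)
  where
  open ≡-Reasoning
  suc-t≡ : suc t ≡ suc (t % r) + t / r * r
  suc-t≡ = cong suc (m≡m%n+[m/n]*n t r)
  quotient : suc t / r ≡ t / r
  quotient = begin
    suc t / r                          ≡⟨ /-congˡ suc-t≡ ⟩
    (suc (t % r) + t / r * r) / r      ≡⟨ +-distrib-/-∣ʳ (suc (t % r)) (divides-refl (t / r)) ⟩
    suc (t % r) / r + t / r * r / r    ≡⟨ cong₂ _+_ (m<n⇒m/n≡0 1+t%r<r) (m*n/n≡m (t / r) r) ⟩
    t / r                              ∎
  remainder : suc t % r ≡ suc (t % r)
  remainder = begin
    suc t % r                          ≡⟨ cong (_% r) suc-t≡ ⟩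
    (suc (t % r) + t / r * r) % r      ≡⟨ [m+kn]%n≡m%n (suc (t % r)) (t / r) r ⟩
    suc (t % r) % r                    ≡⟨ m<n⇒m%n≡m 1+t%r<r ⟩
    suc (t % r)                        ∎
... | no 1+t%r≮r = inj₂ (begin
    suc t / r                          ≡⟨ /-congˡ (cong suc (m≡m%n+[m/n]*n t r)) ⟩
    (suc (t % r) + t / r * r) / r      ≡⟨ /-congˡ (cong (_+ t / r * r) 1+t%r≡r) ⟩
    suc (t / r) * r / r                ≡⟨ m*n/n≡m (suc (t / r)) r ⟩
    suc (t / r)                        ∎)
  where
  open ≡-Reasoning
  1+t%r≡r : suc (t % r) ≡ r
  1+t%r≡r = ≤-antisym (m%n<n t r) (≮⇒≥ 1+t%r≮r)

m%n≡[m+o]%n⇒o%n≡0 : ∀ m o n .{{_ : NonZero n}} → m % n ≡ (m + o) % n → o % n ≡ 0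
m%n≡[m+o]%n⇒o%n≡0 m o n eq = begin
    o % n                      ≡⟨ [m+kn]%n≡m%n o (m / n) n ⟨
    (o + m / n * n) % n        ≡⟨ cong (_% n) (+-comm o _) ⟩
    (m / n * n + o) % n        ≡⟨ cong (_% n) quotients ⟩
    ((m + o) / n * n) % n      ≡⟨ m*n%n≡0 ((m + o) / n) n ⟩
    0                          ∎
  where
  open ≡-Reasoning
  quotients : m / n * n + o ≡ (m + o) / n * n
  quotients = +-cancelˡ-≡ (m % n) _ _ (begin
    m % n + (m / n * n + o)    ≡⟨ +-assoc (m % n) _ o ⟨
    m % n + m / n * n + o      ≡⟨ cong (_+ o) (m≡m%n+[m/n]*n m n) ⟨
    m + o                      ≡⟨ m≡m%n+[m/n]*n (m + o) n ⟩
    (m + o) % n + (m + o) / n * n ≡⟨ cong (_+ (m + o) / n * n) eq ⟨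
    m % n + (m + o) / n * n    ∎)

ceilDiv-positive : ∀ n r .{{_ : NonZero n}} .{{_ : NonZero r}} → 1 ≤ ceilDiv n r
ceilDiv-positive n (suc r') = m≥n⇒m/n>0 (+-monoˡ-≤ r' (>-nonZero⁻¹ n))

n≤ceilDiv*r : ∀ n r .{{_ : NonZero r}} → n ≤ ceilDiv n r * r
n≤ceilDiv*r n r@(suc r') = +-cancelʳ-≤ r' n (ceilDiv n r * r) (begin
  n + r'                              ≡⟨ m≡m%n+[m/n]*n (n + r') r ⟩
  (n + r') % r + ceilDiv n r * r      ≤⟨ +-monoˡ-≤ _ (≤-pred (m%n<n (n + r') r)) ⟩
  r' + ceilDiv n r * r                ≡⟨ +-comm r' _ ⟩
  ceilDiv n r * r + r'                ∎)
  where open ≤-Reasoning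

<ceilDiv⇒*<n : ∀ n r {k} .{{_ : NonZero r}} → k < ceilDiv n r → k * r < n
<ceilDiv⇒*<n n r@(suc r') {k} k<c = +-cancelˡ-≤ r' (suc (k * r)) n (begin
  r' + suc (k * r)     ≡⟨ +-suc r' (k * r) ⟩
  suc k * r            ≤⟨ *-monoˡ-≤ r k<c ⟩
  ceilDiv n r * r      ≤⟨ m/n*n≤m (n + r') r ⟩
  n + r'               ≡⟨ +-comm n r' ⟩
  r' + n               ∎)
  where open ≤-Reasoning

module Stretched (r : ℕ) .{{_ : NonZero r}} (X : ℕ → ℕ) where

  S : ℕ → ℕ
  S = prefixSum (λ t → X (t / r))

  -- lastWeight≤ is the invariant that keeps every weight ≤ r while t runs through the r copies of X d.
  record Regrouping (p t : ℕ) : Set where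
    field
      len         : ℕ
      weight      : ℕ → ℕ
      weight∈A    : ∀ s → p / r ≤ s → s ≤ p / r + len → InA r (weight s)
      ends        : p / r + len ≡ t / r
      lastWeight≤ : weight (t / r) ≤ suc (t % r)
      sum         : S (suc t) ≡ S p + blockSum (λ s → weight s * X s) (p / r) len

  regrouping-refl : ∀ p → Regrouping p p
  regrouping-refl p = record
    { len = 0 ; weight = λ _ → 1 ; weight∈A = λ _ _ _ → ≤-refl , >-nonZero⁻¹ r
    ; ends = +-identityʳ (p / r) ; lastWeight≤ = s≤s z≤n
    ; sum = cong (S p +_) (sym (+-identityʳ (X (p / r)))) }

  regrouping-sameRun : ∀ {p t} → Regrouping p t →
    suc t / r ≡ t / r → suc t % r ≡ suc (t % r) → Regrouping p (suc t)
  regrouping-sameRun {p} {t} R same-/ next-% = record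
    { len = len ; weight = weight′ ; weight∈A = weight′∈A
    ; ends = trans ends (sym same-/)
    ; lastWeight≤ = subst (λ s → weight′ s ≤ suc (suc t % r)) (sym same-/)
        (subst (_≤ suc (suc t % r)) (sym (setAt-≡ weight d _)) bumpedWeight≤)
    ; sum = begin
        S (suc t) + X (suc t / r)        ≡⟨ cong₂ _+_ sum (cong X same-/) ⟩
        S p + B + X d                    ≡⟨ +-assoc (S p) B (X d) ⟩
        S p + (B + X d)                  ≡⟨ cong (S p +_) bumped ⟨
        S p + blockSum (λ s → weight′ s * X s) (p / r) len ∎ }
    where
    open Regrouping R
    open ≡-Reasoning
    d : ℕ
    d = t / r
    weight′ : ℕ → ℕ
    weight′ = setAt weight d (suc (weight d))
    B : ℕ
    B = blockSum (λ s → weight s * X s) (p / r) len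
    bumpedWeight≤ : suc (weight d) ≤ suc (suc t % r)
    bumpedWeight≤ = subst (λ v → suc (weight d) ≤ suc v) (sym next-%) (s≤s lastWeight≤)
    weight′∈A : ∀ s → p / r ≤ s → s ≤ p / r + len → InA r (weight′ s)
    weight′∈A s i≤s s≤ = setAt-elim (InA r) weight d _ s
      (λ _ → s≤s z≤n , ≤-trans bumpedWeight≤ (m%n<n (suc t) r))
      (λ _ → weight∈A s i≤s s≤)
    bumped : blockSum (λ s → weight′ s * X s) (p / r) len ≡ B + X d
    bumped = blockSum-bumpLast (X d) (p / r) len
      (λ s _ s< → cong (_* X s) (setAt-≢ weight d _ (<⇒≢ (subst (s <_) ends s<))))
      (subst (λ s → weight′ s * X s ≡ weight s * X s + X d) (sym ends)
        (trans (cong (_* X d) (setAt-≡ weight d _)) (+-comm (X d) _)))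

  regrouping-nextRun : ∀ {p t} → Regrouping p t → suc t / r ≡ suc (t / r) → Regrouping p (suc t)
  regrouping-nextRun {p} {t} R next-/ = record
    { len = suc len ; weight = weight′ ; weight∈A = weight′∈A
    ; ends = trans (+-suc (p / r) len) (trans (cong suc ends) (sym next-/))
    ; lastWeight≤ = subst (λ s → weight′ s ≤ suc (suc t % r)) (sym next-/)
        (≤-trans (≤-reflexive (setAt-≡ weight (suc d) 1)) (s≤s z≤n))
    ; sum = begin
        S (suc t) + X (suc t / r)        ≡⟨ cong₂ _+_ sum (cong X next-/) ⟩
        S p + B + X (suc d)              ≡⟨ +-assoc (S p) B _ ⟩
        S p + (B + X (suc d))            ≡⟨ cong (S p +_) extended ⟨
        S p + blockSum (λ s → weight′ s * X s) (p / r) (suc len) ∎ }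
    where
    open Regrouping R
    open ≡-Reasoning
    d : ℕ
    d = t / r
    weight′ : ℕ → ℕ
    weight′ = setAt weight (suc d) 1
    B : ℕ
    B = blockSum (λ s → weight s * X s) (p / r) len
    weight′∈A : ∀ s → p / r ≤ s → s ≤ p / r + suc len → InA r (weight′ s)
    weight′∈A s i≤s s≤ = setAt-elim (InA r) weight (suc d) 1 s
      (λ _ → ≤-refl , >-nonZero⁻¹ r)
      (λ s≢1+d → weight∈A s i≤s (subst (s ≤_) (sym ends)
        (≤-pred (≤∧≢⇒< (subst (s ≤_) (trans (+-suc (p / r) len) (cong suc ends)) s≤) s≢1+d))))
    extended : blockSum (λ s → weight′ s * X s) (p / r) (suc len) ≡ B + X (suc d)
    extended = begin
      blockSum (λ s → weight′ s * X s) (p / r) (suc len)   ≡⟨ blockSum-snoc _ (p / r) len ⟩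
      blockSum (λ s → weight′ s * X s) (p / r) len + weight′ (suc (p / r + len)) * X (suc (p / r + len))
        ≡⟨ cong₂ _+_ (blockSum-cong (p / r) len λ s _ s≤ → cong (_* X s) (setAt-≢ weight (suc d) 1
             λ s≡1+d → 1+n≰n (subst (_≤ d) s≡1+d (subst (s ≤_) ends s≤))))
           (cong (λ s → weight′ (suc s) * X (suc s)) ends) ⟩
      B + weight′ (suc d) * X (suc d)                       ≡⟨ cong (λ v → B + v * X (suc d)) (setAt-≡ weight (suc d) 1) ⟩
      B + (X (suc d) + 0)                                   ≡⟨ cong (B +_) (+-identityʳ _) ⟩
      B + X (suc d)                                         ∎

  regrouping : ∀ {p t} → p ≤′ t → Regrouping p t
  regrouping {p} ≤′-refl = regrouping-refl p
  regrouping {p} {suc t} (≤′-step p≤t) with suc-/-% t r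
  ... | inj₁ (same-/ , next-%) = regrouping-sameRun (regrouping p≤t) same-/ next-%
  ... | inj₂ next-/            = regrouping-nextRun (regrouping p≤t) next-/

zeroSumBlock-from-collision : ∀ n r k .{{_ : NonZero n}} .{{_ : NonZero r}} (x : Fin k → Fin n) {p q} →
  p < q → q ≤ k * r → Stretched.S r (seqAt x) p % n ≡ Stretched.S r (seqAt x) q % n →
  HasZeroSumBlock n r k x
zeroSumBlock-from-collision n r k x {p} {suc t} (s≤s p≤t) t<kr Sp≡Sq =
  p / r , len , subst (_< k) (sym ends) (m<n*o⇒m/o<n t<kr) , weight , weight∈A ,
  m%n≡[m+o]%n⇒o%n≡0 (S p) _ n (trans Sp≡Sq (cong (_% n) sum))
  where
  open Stretched r (seqAt x)
  open Regrouping (regrouping (≤⇒≤′ p≤t))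

allHave-ceilDiv : ∀ n r .{{_ : NonZero n}} .{{_ : NonZero r}} → AllHave n r (ceilDiv n r)
allHave-ceilDiv n r x
  with p , q , p<q , Sp≡Sq ← pigeonhole (s≤s (n≤ceilDiv*r n r)) (λ t → Stretched.S r (seqAt x) (toℕ t) mod n)
  = zeroSumBlock-from-collision n r (ceilDiv n r) x p<q (≤-pred (toℕ<n q))
      (trans (sym (toℕ-fromℕ< (m%n<n _ n))) (trans (cong toℕ Sp≡Sq) (toℕ-fromℕ< (m%n<n _ n))))

seqAt-const : ∀ {n k} (o : Fin n) t → t < k → seqAt {n} {k} (λ _ → o) t ≡ toℕ o
seqAt-const {k = k} o t t<k with t <? k
... | yes _   = refl
... | no t≮k = contradiction t<k t≮k

¬allHave-below-ceilDiv : ∀ n r {k} .{{_ : NonZero n}} .{{_ : NonZero r}} →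
  1 < n → k < ceilDiv n r → ¬ AllHave n r k
¬allHave-below-ceilDiv n r {k} 1<n k<c allHave
  with i , m , i+m<k , a , a∈A , block%n≡0 ← allHave (λ _ → fromℕ< 1<n) =
  contradiction (trans (sym (m<n⇒m%n≡m block<n)) block%n≡0) (≢-sym (<⇒≢ 0<block))
  where
  open ≤-Reasoning
  block : ℕ
  block = blockSum (λ t → a t * seqAt {n} {k} (λ _ → fromℕ< 1<n) t) i m
  weightsOnly : block ≡ blockSum a i m
  weightsOnly = blockSum-cong i m λ t _ t≤ →
    trans (cong (a t *_) (trans (seqAt-const _ t (≤-<-trans t≤ i+m<k)) (toℕ-fromℕ< 1<n))) (*-identityʳ (a t))
  0<block : 0 < block
  0<block = begin-strict
    0                   <⟨ proj₁ (a∈A i ≤-refl (m≤m+n i m)) ⟩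
    a i                 ≤⟨ head≤blockSum a i m ⟩
    blockSum a i m      ≡⟨ weightsOnly ⟨
    block               ∎
  block<n : block < n
  block<n = begin-strict
    block               ≡⟨ weightsOnly ⟩
    blockSum a i m      ≤⟨ blockSum-≤ r i m (λ t i≤t t≤ → proj₂ (a∈A t i≤t t≤)) ⟩
    suc m * r           ≤⟨ *-monoˡ-≤ r (≤-trans (s≤s (m≤n+m m i)) i+m<k) ⟩
    k * r               <⟨ <ceilDiv⇒*<n n r k<c ⟩
    n                   ∎

mainTheorem4 : (n r : ℕ) .{{_ : NonZero n}} .{{_ : NonZero r}} →
    1 ≤ r → r ≤ n ∸ 1 → IsCA n r (ceilDiv n r)
mainTheorem4 n r 1≤r r≤n∸1 =
  ceilDiv-positive n r , allHave-ceilDiv n r ,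
  λ k _ allHave → ≮⇒≥ λ k<c → ¬allHave-below-ceilDiv n r 1<n k<c allHave
  where
  1<n : 1 < n
  1<n = m≤o∸n⇒m+n≤o 1 (>-nonZero⁻¹ n) (≤-trans 1≤r r≤n∸1)
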